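{- Let $p>3$ be prime, let $\Pi$ be a projective plane of order $p^2$, let $c\in\mathrm{C}(\Pi)^\perp$ have weight $2p^2-2p+2+\epsilon$ with $1\leq\epsilon\leq p-2$, and for $\lambda\in\{1,\dots,p-1\}$ let $K_\lambda$ be the set of points where $c$ has entry $\lambda$. Then there is no $\lambda$ occurring as an entry of $c$ such that $|K_\lambda|=|K_{p-\lambda}|=2p+1-\epsilon$.
   Context: $\mathrm{C}(\Pi)$ is the $\mathbb{F}_p$-span of the incidence vectors of the lines of $\Pi$, viewed as vectors indexed by points; $\mathrm{C}(\Pi)^\perp$ is the set of vectors $v$ with $\sum_{P\in\ell}v_P=0$ in $\mathbb{F}_p$ for every line $\ell$. The weight is the number of non-zero positions. Elements of $\mathbb{F}_p$ are represented by integers in $\{0,\dots,p-1\}$. -}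

module Defs where

open import Data.Nat using (ℕ; zero; suc; _+_; _%_; _≟_)
open import Data.Nat.ListAction using (sum)
open import Data.Nat.Divisibility using (_∣_)
open import Data.Bool using (Bool; true; false; T; T?)
open import Data.Fin using (Fin; toℕ)
open import Data.List using (List; length; filter; map; allFin)
open import Data.Product using (Σ; ∃; _×_; _,_)
open import Relation.Nullary using (¬_; Dec; ¬?)
open import Relation.Unary using (Pred; Decidable)
open import Relation.Binary.PropositionalEquality using (_≡_; _≢_)
open import Level using (0ℓ)

count : {n : ℕ} (P : Pred (Fin n) 0ℓ) → Decidable P → ℕ
count {n} P P? = length (filter P? (allFin n))

record ProjectivePlane (q : ℕ) : Set where
  field
    nPoints : ℕ
    nLines  : ℕ
    inc     : Fin nPoints → Fin nLines → Bool
  _∈ℓ_ : Fin nPoints → Fin nLines → Set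
  P ∈ℓ ℓ = T (inc P ℓ)
  field
    joinLine  : (P Q : Fin nPoints) → P ≢ Q →
                Σ (Fin nLines) λ ℓ → (P ∈ℓ ℓ × Q ∈ℓ ℓ) ×
                  ((m : Fin nLines) → P ∈ℓ m → Q ∈ℓ m → m ≡ ℓ)
    meetPoint : (ℓ m : Fin nLines) → ℓ ≢ m →
                Σ (Fin nPoints) λ P → (P ∈ℓ ℓ × P ∈ℓ m) ×
                  ((Q : Fin nPoints) → Q ∈ℓ ℓ → Q ∈ℓ m → Q ≡ P)
    nondegenerate :
      Σ (Fin nPoints) λ A → Σ (Fin nPoints) λ B →
      Σ (Fin nPoints) λ C → Σ (Fin nPoints) λ D →
        (A ≢ B) × (A ≢ C) × (A ≢ D) × (B ≢ C) × (B ≢ D) × (C ≢ D) ×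
        ((ℓ : Fin nLines) →
           ¬ (A ∈ℓ ℓ × B ∈ℓ ℓ × C ∈ℓ ℓ) × ¬ (A ∈ℓ ℓ × B ∈ℓ ℓ × D ∈ℓ ℓ) ×
           ¬ (A ∈ℓ ℓ × C ∈ℓ ℓ × D ∈ℓ ℓ) × ¬ (B ∈ℓ ℓ × C ∈ℓ ℓ × D ∈ℓ ℓ))
    lineSize : (ℓ : Fin nLines) → count (λ P → P ∈ℓ ℓ) (λ P → T? (inc P ℓ)) ≡ suc q

open ProjectivePlane public

-- A word over F_p indexed by the points of Π; entries of F_p are
-- represented by Fin p, i.e. integers in {0,…,p-1}.
Word : {q : ℕ} → ProjectivePlane q → ℕ → Set
Word Π p = Fin (nPoints Π) → Fin p

lineSum : {q p : ℕ} (Π : ProjectivePlane q) → Word Π p → Fin (nLines Π) → ℕ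
lineSum Π c ℓ = sum (map (λ P → toℕ (c P))
                         (filter (λ P → T? (inc Π P ℓ)) (allFin (nPoints Π))))

-- c ∈ C(Π)^⊥ : the sum over every line is 0 in F_p
InDualCode : {q p : ℕ} (Π : ProjectivePlane q) → Word Π p → Set
InDualCode {p = p} Π c = (ℓ : Fin (nLines Π)) → p ∣ lineSum Π c ℓ

weight : {q p : ℕ} (Π : ProjectivePlane q) → Word Π p → ℕ
weight Π c = count (λ P → toℕ (c P) ≢ 0)
                   (λ P → ¬? (toℕ (c P) ≟ 0))

Kcard : {q p : ℕ} (Π : ProjectivePlane q) → Word Π p → ℕ → ℕ
Kcard Π c k = count (λ P → toℕ (c P) ≡ k) (λ P → toℕ (c P) ≟ k)

{-# OPTIONS --safe #-}

-- Let j = p − k, m = |K_k| = |K_j| and w the weight, so that w + m = 2q + 3 with q = p².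
-- A support point P whose partner class K_{p − c_P} has at most m points lies on no line
-- carrying three further support points.  So if Y is another support point with
-- c_P + c_Y ≢ 0, the line PY carries exactly one more support point Z, with
-- c_Z ≡ −(c_P + c_Y), and for fixed P the point Z determines Y.  Take P₀ ≠ P′ in K_k, let R
-- be the third point on P₀P′ (so c_R ≡ −2k), and take Q₀ ∈ K_j.  Passing to third points on
-- lines through R, Q₀ and P₀ gives injections
--   K_j → {c ≡ 3k} → {c ≡ −2k} → K_k ∖ {P₀},
-- contradicting |K_j| = |K_k|.  Primality and p > 3 make 2, 3 and 4 invertible mod p.

module Submission where

open import Defs
open import Data.Bool using (T; T?)
open import Data.Nat using (ℕ; zero; suc; _+_; _*_; _∸_; _≤_; _<_; z≤n; s≤s; _≟_; _≤?_)
open import Data.Nat.Properties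
open import Data.Nat.ListAction using (sum)
open import Data.Nat.Divisibility
  using (_∣_; _∣?_; divides; ∣-refl; ∣⇒≤; n∣m*n; ∣m+n∣m⇒∣n; ∣m∣n⇒∣m+n)
open import Data.Nat.Primality using (Prime; euclidsLemma)
open import Data.Fin using (Fin; toℕ)
import Data.Fin as Fin
import Data.Fin.Properties as Fin
open import Data.List using (List; []; _∷_; _++_; [_]; length; map; filter; tabulate)
open import Data.List.Membership.Propositional using (_∈_; _∉_)
open import Data.List.Membership.Propositional.Properties using (∈-++⁺ˡ; ∈-++⁺ʳ)
open import Data.List.Relation.Unary.All using (All; []; _∷_; lookup)
open import Data.List.Relation.Unary.All.Properties using (All¬⇒¬Any)
open import Data.List.Relation.Unary.Any using (here; there; any?)
open import Data.List.Relation.Unary.Unique.Propositional using (Unique; []; _∷_)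
open import Data.Product using (Σ; ∃; _×_; _,_; proj₁; proj₂)
open import Data.Sum using (_⊎_; inj₁; inj₂)
open import Data.Empty using (⊥)
open import Function using (_∘_; id)
open import Level using (0ℓ)
open import Data.Nat.Tactic.RingSolver using (solve-∀)
open import Relation.Nullary using (¬_; Dec; yes; no; ¬?; _×-dec_; contradiction)
open import Relation.Unary using (Pred; Decidable)
open import Relation.Binary.PropositionalEquality
  using (_≡_; _≢_; refl; sym; trans; cong; cong₂; subst; module ≡-Reasoning)
open import Algebra.Properties.Semiring.Sum +-*-semiring
  using ( sum-syntax; sum-replicate-zero; sum-cong-≗; ∑-distrib-+; ∑-comm
        ; *-distribˡ-sum; *-distribʳ-sum)

-- Counting over finite sets

private
  variable
    A B : Set

𝟙 : Dec A → ℕ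
𝟙 (yes _) = 1
𝟙 (no _)  = 0

𝟙-yes : (a? : Dec A) → A → 𝟙 a? ≡ 1
𝟙-yes (yes _) _ = refl
𝟙-yes (no ¬a) a = contradiction a ¬a

𝟙-no : (a? : Dec A) → ¬ A → 𝟙 a? ≡ 0
𝟙-no (yes a) ¬a = contradiction a ¬a
𝟙-no (no _)  _  = refl

𝟙-pos : (a? : Dec A) → 0 < 𝟙 a? → A
𝟙-pos (yes a) _ = a

𝟙-cong : (a? : Dec A) (b? : Dec B) → (A → B) → (B → A) → 𝟙 a? ≡ 𝟙 b?
𝟙-cong (yes a) b? f g = sym (𝟙-yes b? (f a))
𝟙-cong (no ¬a) b? f g = sym (𝟙-no b? (¬a ∘ g))

𝟙-mono : (a? : Dec A) (b? : Dec B) → (A → B) → 𝟙 a? ≤ 𝟙 b?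
𝟙-mono (yes a) b? f = ≤-reflexive (sym (𝟙-yes b? (f a)))
𝟙-mono (no _)  b? f = z≤n

𝟙-split : (a? : Dec A) (b? : Dec B) → (B → A) → 𝟙 a? ≡ 𝟙 (a? ×-dec ¬? b?) + 𝟙 b?
𝟙-split (yes _) (yes _) _   = refl
𝟙-split (yes _) (no _)  _   = refl
𝟙-split (no ¬a) (yes b) B⇒A = contradiction (B⇒A b) ¬a
𝟙-split (no _)  (no _)  _   = refl

𝟙-× : (a? : Dec A) (b? : Dec B) → 𝟙 a? * 𝟙 b? ≡ 𝟙 (a? ×-dec b?)
𝟙-× (yes _) (yes _) = refl
𝟙-× (yes _) (no _)  = refl
𝟙-× (no _)  _       = refl

private
  variable
    n : ℕ
    P Q : Pred (Fin n) 0ℓ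

∑-mono : {f g : Fin n → ℕ} → (∀ x → f x ≤ g x) → ∑[ x < n ] f x ≤ ∑[ x < n ] g x
∑-mono {zero}  f≤g = z≤n
∑-mono {suc n} f≤g = +-mono-≤ (f≤g Fin.zero) (∑-mono (f≤g ∘ Fin.suc))

∑-pos : (f : Fin n → ℕ) → 0 < ∑[ x < n ] f x → ∃ λ x → 0 < f x
∑-pos {suc n} f ∑f>0 with f Fin.zero in eq
... | suc _ = Fin.zero , subst (0 <_) (sym eq) (s≤s z≤n)
... | zero  = let (x , fx>0) = ∑-pos (f ∘ Fin.suc) ∑f>0 in Fin.suc x , fx>0

card : {n : ℕ} {P : Pred (Fin n) 0ℓ} → Decidable P → ℕ
card {n} P? = ∑[ x < n ] 𝟙 (P? x)

infix 4 _∈?_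
_∈?_ : (x : Fin n) (xs : List (Fin n)) → Dec (x ∈ xs)
x ∈? xs = any? (x Fin.≟_) xs

infixl 6 _∖?_
_∖?_ : Decidable P → (xs : List (Fin n)) → Decidable (λ x → P x × x ∉ xs)
(P? ∖? xs) x = P? x ×-dec ¬? (x ∈? xs)

card-cong : (P? : Decidable P) (Q? : Decidable Q) →
            (∀ {x} → P x → Q x) → (∀ {x} → Q x → P x) → card P? ≡ card Q?
card-cong P? Q? P⇒Q Q⇒P = sum-cong-≗ λ x → 𝟙-cong (P? x) (Q? x) P⇒Q Q⇒P

card-mono : (P? : Decidable P) (Q? : Decidable Q) → (∀ {x} → P x → Q x) → card P? ≤ card Q?
card-mono P? Q? P⇒Q = ∑-mono λ x → 𝟙-mono (P? x) (Q? x) P⇒Q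

card-witness : (P? : Decidable P) → 0 < card P? → ∃ P
card-witness P? card>0 = let (x , 𝟙>0) = ∑-pos _ card>0 in x , 𝟙-pos (P? x) 𝟙>0

card-singleton : (x : Fin n) → card (x Fin.≟_) ≡ 1
card-singleton {suc n} Fin.zero = cong suc (sum-replicate-zero n)
card-singleton {suc n} (Fin.suc x) = trans
  (sum-cong-≗ λ y → 𝟙-cong (Fin.suc x Fin.≟ Fin.suc y) (x Fin.≟ y) Fin.suc-injective (cong Fin.suc))
  (card-singleton x)

card-∅ : (P? : Decidable P) → (∀ x → ¬ P x) → card P? ≡ 0
card-∅ {n} P? empty = trans (sum-cong-≗ λ x → 𝟙-no (P? x) (empty x)) (sum-replicate-zero n)

card-pos : (P? : Decidable P) {x : Fin n} → P x → 0 < card P?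
card-pos P? {x} Px = subst (_≤ card P?) (card-singleton x) (card-mono (x Fin.≟_) P? λ { refl → Px })

card-unique : (P? : Decidable P) {x : Fin n} → P x → (∀ {y} → P y → y ≡ x) → card P? ≡ 1
card-unique P? {x} Px unique =
  trans (card-cong P? (x Fin.≟_) (sym ∘ unique) (λ { refl → Px })) (card-singleton x)

card-≤1 : (P? : Decidable P) → (∀ {x y} → P x → P y → x ≡ y) → card P? ≤ 1
card-≤1 P? subsingleton with card P? in eq
... | zero  = z≤n
... | suc _ = let (x , Px) = card-witness P? (subst (0 <_) (sym eq) (s≤s z≤n)) in
  subst (_≤ 1) eq (≤-reflexive (card-unique P? Px (λ Py → subsingleton Py Px)))

∑-∈ : {xs : List (Fin n)} → Unique xs → (f : Fin n → ℕ) →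
      ∑[ y < n ] (𝟙 (y ∈? xs) * f y) ≡ sum (map f xs)
∑-∈ {n} [] f = sum-replicate-zero n
∑-∈ {n} {x ∷ xs} (x∉xs ∷ unique) f = begin
  ∑[ y < n ] (𝟙 (y ∈? x ∷ xs) * f y)                         ≡⟨ sum-cong-≗ split ⟩
  ∑[ y < n ] (𝟙 (x Fin.≟ y) * f x + 𝟙 (y ∈? xs) * f y)
       ≡⟨ ∑-distrib-+ (λ y → 𝟙 (x Fin.≟ y) * f x) (λ y → 𝟙 (y ∈? xs) * f y) ⟩
  (∑[ y < n ] (𝟙 (x Fin.≟ y) * f x)) + (∑[ y < n ] (𝟙 (y ∈? xs) * f y))
       ≡⟨ cong₂ _+_ (sym (*-distribʳ-sum (f x) (λ y → 𝟙 (x Fin.≟ y)))) (∑-∈ unique f) ⟩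
  card (x Fin.≟_) * f x + sum (map f xs)   ≡⟨ cong (λ k → k * f x + _) (card-singleton x) ⟩
  1 * f x + sum (map f xs)                 ≡⟨ cong (_+ sum (map f xs)) (*-identityˡ (f x)) ⟩
  f x + sum (map f xs)                     ∎
  where
  open ≡-Reasoning
  split : ∀ y → 𝟙 (y ∈? x ∷ xs) * f y ≡ 𝟙 (x Fin.≟ y) * f x + 𝟙 (y ∈? xs) * f y
  split y with x Fin.≟ y
  ... | yes refl rewrite 𝟙-yes (x ∈? x ∷ xs) (here refl) | 𝟙-no (x ∈? xs) (All¬⇒¬Any x∉xs) =
    sym (+-identityʳ _)
  ... | no x≢y = cong (_* f y) (𝟙-cong (y ∈? x ∷ xs) (y ∈? xs) (λ { (here refl) → contradiction refl x≢y
                                                                 ; (there y∈xs) → y∈xs })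
                                                            there)

card-∈ : {xs : List (Fin n)} → Unique xs → card (_∈? xs) ≡ length xs
card-∈ {xs = xs} unique =
  trans (sum-cong-≗ λ y → sym (*-identityʳ (𝟙 (y ∈? xs)))) (trans (∑-∈ unique (λ _ → 1)) (sum-map-1 xs))
  where
  sum-map-1 : (ys : List (Fin _)) → sum (map (λ _ → 1) ys) ≡ length ys
  sum-map-1 []       = refl
  sum-map-1 (_ ∷ ys) = cong suc (sum-map-1 ys)

card-split : (P? : Decidable P) {xs : List (Fin n)} → Unique xs → All P xs →
             card P? ≡ card (P? ∖? xs) + length xs
card-split {n = n} P? {xs} unique allP = begin
  card P?                                        ≡⟨ sum-cong-≗ split ⟩
  ∑[ y < n ] (𝟙 ((P? ∖? xs) y) + 𝟙 (y ∈? xs))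
    ≡⟨ ∑-distrib-+ (λ y → 𝟙 ((P? ∖? xs) y)) (λ y → 𝟙 (y ∈? xs)) ⟩
  card (P? ∖? xs) + card (_∈? xs)               ≡⟨ cong (card (P? ∖? xs) +_) (card-∈ unique) ⟩
  card (P? ∖? xs) + length xs                   ∎
  where
  open ≡-Reasoning
  split : ∀ y → 𝟙 (P? y) ≡ 𝟙 ((P? ∖? xs) y) + 𝟙 (y ∈? xs)
  split y = 𝟙-split (P? y) (y ∈? xs) (lookup allP)

card∖≤length⇒⊆++ : (P? : Decidable P) {ys xs : List (Fin n)} →
                   Unique xs → All (λ x → P x × x ∉ ys) xs → card (P? ∖? ys) ≤ length xs →
                   ∀ {w} → P w → w ∈ ys ++ xs
card∖≤length⇒⊆++ P? {ys} {xs} unique allP card≤ {w} Pw with w ∈? ys | w ∈? xs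
... | yes w∈ys | _       = ∈-++⁺ˡ w∈ys
... | no _     | yes w∈xs = ∈-++⁺ʳ ys w∈xs
... | no w∉ys  | no w∉xs  =
  contradiction (card-pos ((P? ∖? ys) ∖? xs) ((Pw , w∉ys) , w∉xs)) (<-irrefl (sym rest≡0))
  where
  rest≡0 : card ((P? ∖? ys) ∖? xs) ≡ 0
  rest≡0 = n≤0⇒n≡0 (+-cancelʳ-≤ (length xs) _ 0
             (subst (_≤ length xs) (card-split (P? ∖? ys) unique allP) card≤))

module _ {m n : ℕ} {A : Pred (Fin m) 0ℓ} {B : Pred (Fin n) 0ℓ} (A? : Decidable A) (B? : Decidable B)
         (f : ∀ x → A x → Fin n) (f∈B : ∀ x a → B (f x a))
         (f-inj : ∀ {x y} a b → f x a ≡ f y b → x ≡ y) where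

  private
    Hits : (x : Fin m) → Dec (A x) → Fin n → Set
    Hits x (yes a) y = f x a ≡ y
    Hits x (no _)  y = ⊥

    hits? : (x : Fin m) (a? : Dec (A x)) (y : Fin n) → Dec (Hits x a? y)
    hits? x (yes a) y = f x a Fin.≟ y
    hits? x (no _)  y = no λ ()

    row : ∀ x (a? : Dec (A x)) → card (hits? x a?) ≡ 𝟙 a?
    row x (yes a) = card-singleton (f x a)
    row x (no _)  = sum-replicate-zero n

    hits⇒B : ∀ {x y} (a? : Dec (A x)) → Hits x a? y → B y
    hits⇒B {x} (yes a) refl = f∈B x a

    hits-inj : ∀ {x x′ y} (a? : Dec (A x)) (a′? : Dec (A x′)) →
               Hits x a? y → Hits x′ a′? y → x ≡ x′
    hits-inj (yes a) (yes a′) fa≡y fa′≡y = f-inj a a′ (trans fa≡y (sym fa′≡y))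

    column : ∀ y → card (λ x → hits? x (A? x) y) ≤ 𝟙 (B? y)
    column y with B? y
    ... | yes _  = card-≤1 (λ x → hits? x (A? x) y) (λ {x} {x′} → hits-inj (A? x) (A? x′))
    ... | no ¬By = ≤-reflexive (card-∅ (λ x → hits? x (A? x) y) λ x → ¬By ∘ hits⇒B (A? x))

  card-injection : card A? ≤ card B?
  card-injection = begin
    card A?                                         ≡⟨ sum-cong-≗ (λ x → sym (row x (A? x))) ⟩
    ∑[ x < m ] card (hits? x (A? x))                ≡⟨ ∑-comm (λ x y → 𝟙 (hits? x (A? x) y)) ⟩
    ∑[ y < n ] card (λ x → hits? x (A? x) y)        ≤⟨ ∑-mono column ⟩
    card B?                                         ∎
    where open ≤-Reasoning

module _ {R : Pred A 0ℓ} (R? : Decidable R) where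

  length-filter-tabulate : (f : Fin n → A) →
                           length (filter R? (tabulate f)) ≡ ∑[ i < n ] 𝟙 (R? (f i))
  length-filter-tabulate {zero}  f = refl
  length-filter-tabulate {suc n} f with R? (f Fin.zero)
  ... | yes _ = cong suc (length-filter-tabulate (f ∘ Fin.suc))
  ... | no _  = length-filter-tabulate (f ∘ Fin.suc)

  sum-map-filter-tabulate : (g : A → ℕ) (f : Fin n → A) →
    sum (map g (filter R? (tabulate f))) ≡ ∑[ i < n ] (𝟙 (R? (f i)) * g (f i))
  sum-map-filter-tabulate {zero}  g f = refl
  sum-map-filter-tabulate {suc n} g f with R? (f Fin.zero)
  ... | yes _ = cong₂ _+_ (sym (+-identityʳ _)) (sum-map-filter-tabulate g (f ∘ Fin.suc))
  ... | no _  = sum-map-filter-tabulate g (f ∘ Fin.suc)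

count≡card : (P? : Decidable P) → count P P? ≡ card P?
count≡card P? = length-filter-tabulate P? id

-- Projective planes

module Plane {q : ℕ} (Π : ProjectivePlane q) where

  Point Line : Set
  Point = Fin (nPoints Π)
  Line  = Fin (nLines Π)

  infix 4 _on_ _on?_
  _on_ : Point → Line → Set
  X on L = T (inc Π X L)

  _on?_ : (X : Point) (L : Line) → Dec (X on L)
  X on? L = T? (inc Π X L)

  private
    variable
      X Y : Point
      L M : Line

  join : (X Y : Point) → X ≢ Y → Σ Line λ L → X on L × Y on L
  join X Y X≢Y = proj₁ (joinLine Π X Y X≢Y) , proj₁ (proj₂ (joinLine Π X Y X≢Y))

  meet : (L M : Line) → L ≢ M → Σ Point λ X → X on L × X on M
  meet L M L≢M = proj₁ (meetPoint Π L M L≢M) , proj₁ (proj₂ (meetPoint Π L M L≢M))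

  line-unique : X ≢ Y → X on L → Y on L → X on M → Y on M → L ≡ M
  line-unique {X} {Y} X≢Y XL YL XM YM =
    let unique = proj₂ (proj₂ (joinLine Π X Y X≢Y)) in trans (unique _ XL YL) (sym (unique _ XM YM))

  point-unique : L ≢ M → X on L → X on M → Y on L → Y on M → X ≡ Y
  point-unique {L} {M} L≢M XL XM YL YM =
    let unique = proj₂ (proj₂ (meetPoint Π L M L≢M)) in trans (unique _ XL XM) (sym (unique _ YL YM))

  missing-line : (P : Point) → ∃ λ L → ¬ P on L
  missing-line P with nondegenerate Π
  ... | A , B , C , D , A≢B , A≢C , _ , _ , _ , C≢D , noThree
    with join A B A≢B | join C D C≢D | join A C A≢C
  ... | AB , A-AB , B-AB | CD , C-CD , D-CD | AC , A-AC , C-AC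
    with P on? AB | P on? CD | P on? AC
  ... | no P∉AB | _ | _ = AB , P∉AB
  ... | yes _ | no P∉CD | _ = CD , P∉CD
  ... | yes _ | yes _ | no P∉AC = AC , P∉AC
  ... | yes P-AB | yes P-CD | yes P-AC with P Fin.≟ A
  ...   | yes refl = contradiction (P-CD , C-CD , D-CD) (proj₁ (proj₂ (proj₂ (noThree CD))))
  ...   | no P≢A   =
    contradiction (A-AB , B-AB , subst (C on_) (line-unique P≢A P-AC A-AC P-AB A-AB) C-AC) (proj₁ (noThree AB))

  line-card : (L : Line) → card (_on? L) ≡ suc q
  line-card L = trans (sym (count≡card (_on? L))) (lineSize Π L)

  pencil-card : (P : Point) → card (P on?_) ≡ suc q
  pencil-card P = trans (≤-antisym lines≤points points≤lines) (line-card L₀)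
    where
    L₀ = proj₁ (missing-line P)
    P∉L₀ = proj₂ (missing-line P)

    ≢L₀ : P on L → L ≢ L₀
    ≢L₀ P-L refl = P∉L₀ P-L

    P≢ : X on L₀ → P ≢ X
    P≢ X-L₀ refl = P∉L₀ X-L₀

    lines≤points : card (P on?_) ≤ card (_on? L₀)
    lines≤points = card-injection (P on?_) (_on? L₀)
      (λ L P-L → proj₁ (meet L L₀ (≢L₀ P-L)))
      (λ L P-L → proj₂ (proj₂ (meet L L₀ (≢L₀ P-L))))
      (λ {L} {L′} P-L P-L′ same →
        let (X , X-L , X-L₀) = meet L L₀ (≢L₀ P-L)
            (_ , X′-L′ , _)  = meet L′ L₀ (≢L₀ P-L′)
        in line-unique (P≢ X-L₀) P-L X-L P-L′ (subst (_on L′) (sym same) X′-L′))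

    points≤lines : card (_on? L₀) ≤ card (P on?_)
    points≤lines = card-injection (_on? L₀) (P on?_)
      (λ X X-L₀ → proj₁ (join P X (P≢ X-L₀)))
      (λ X X-L₀ → proj₁ (proj₂ (join P X (P≢ X-L₀))))
      (λ {X} {X′} X-L₀ X′-L₀ same →
        let (L , P-L , X-L)   = join P X (P≢ X-L₀)
            (_ , _ , X′-L′) = join P X′ (P≢ X′-L₀)
        in point-unique (≢L₀ P-L) X-L X-L₀ (subst (X′ on_) (sym same) X′-L′) X′-L₀)

-- Codewords of the dual code

¬∣-pos : ∀ {p a} → 0 < a → a < p → ¬ p ∣ a
¬∣-pos {a = suc _} _ a<p p∣a = <⇒≱ a<p (∣⇒≤ p∣a)

∣-complement : ∀ {p a b} → p ∣ a + b → 0 < b → a < p → b < p → b ≡ p ∸ a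
∣-complement {p} {a} {b} p∣a+b 0<b a<p b<p = begin
  b           ≡⟨ m+n∸m≡n a b ⟨
  a + b ∸ a   ≡⟨ cong (_∸ a) (∣-between p∣a+b (<-≤-trans 0<b (m≤n+m b a)) (+-mono-< a<p b<p)) ⟩
  p ∸ a       ∎
  where
  open ≡-Reasoning
  ∣-between : ∀ {x} → p ∣ x → 0 < x → x < p + p → x ≡ p
  ∣-between (divides 1 refl)             _ _    = +-identityʳ p
  ∣-between (divides (suc (suc k)) refl) _ x<2p = contradiction (+-monoʳ-≤ p (m≤m+n p (k * p))) (<⇒≱ x<2p)

two-plus-excess : ∀ k → 1 ≤ k → 2 + 𝟙 (3 ≤? k) ≤ k + 𝟙 (k ≟ 1)
two-plus-excess 1                   _ = ≤-refl
two-plus-excess 2                   _ = ≤-refl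
two-plus-excess (suc (suc (suc k))) _ = s≤s (s≤s (s≤s z≤n))

𝟙-two-plus-excess : (a? : Dec A) (k : ℕ) → (A → 1 ≤ k) →
                    2 * 𝟙 a? + 𝟙 (a? ×-dec (3 ≤? k)) ≤ 𝟙 a? * k + 𝟙 (a? ×-dec (k ≟ 1))
𝟙-two-plus-excess (no _)  k _    = z≤n
𝟙-two-plus-excess (yes a) k 1≤k = begin
  2 + 𝟙 (yes a ×-dec (3 ≤? k))     ≡⟨ cong (2 +_) (𝟙-cong (yes a ×-dec (3 ≤? k)) (3 ≤? k) proj₂ (a ,_)) ⟩
  2 + 𝟙 (3 ≤? k)                   ≤⟨ two-plus-excess k (1≤k a) ⟩
  k + 𝟙 (k ≟ 1)                    ≡⟨ cong₂ _+_ (sym (*-identityˡ k))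
                                               (𝟙-cong (k ≟ 1) (yes a ×-dec (k ≟ 1)) (a ,_) proj₂) ⟩
  1 * k + 𝟙 (yes a ×-dec (k ≟ 1))  ∎
  where open ≤-Reasoning

≤∸1⇒< : ∀ {m n} → 0 < n → m ≤ n ∸ 1 → m < n
≤∸1⇒< {n = suc _} _ = s≤s

p∤n*t : ∀ {p n t} → Prime p → 0 < n → n < p → 0 < t → t < p → ¬ p ∣ n * t
p∤n*t {n = n} {t} p-prime 0<n n<p 0<t t<p p∣n*t with euclidsLemma n t p-prime p∣n*t
... | inj₁ p∣n = ¬∣-pos 0<n n<p p∣n
... | inj₂ p∣t = ¬∣-pos 0<t t<p p∣t

module Codeword {q p : ℕ} (Π : ProjectivePlane q) (c : Word Π p) (c∈C⊥ : InDualCode Π c) where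

  open Plane Π

  private
    variable
      L : Line

  v : Point → ℕ
  v X = toℕ (c X)

  v<p : ∀ X → v X < p
  v<p X = Fin.toℕ<n (c X)

  Supp : Pred Point 0ℓ
  Supp X = v X ≢ 0

  supp? : Decidable Supp
  supp? X = ¬? (v X ≟ 0)

  Kcard≡card : ∀ t → Kcard Π c t ≡ card (λ Y → v Y ≟ t)
  Kcard≡card t = count≡card (λ Y → v Y ≟ t)

  SuppOn : Line → Pred Point 0ℓ
  SuppOn L X = Supp X × X on L

  suppOn? : (L : Line) → Decidable (SuppOn L)
  suppOn? L X = supp? X ×-dec X on? L

  lineSum-covered : {xs : List Point} → Unique xs → All (_on L) xs →
                    (∀ {W} → SuppOn L W → W ∈ xs) → lineSum Π c L ≡ sum (map v xs)
  lineSum-covered {L} {xs} unique all-on covered = begin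
    lineSum Π c L                              ≡⟨ sum-map-filter-tabulate (_on? L) v id ⟩
    ∑[ W < nPoints Π ] (𝟙 (W on? L) * v W)     ≡⟨ sum-cong-≗ on⇔∈ ⟩
    ∑[ W < nPoints Π ] (𝟙 (W ∈? xs) * v W)     ≡⟨ ∑-∈ unique v ⟩
    sum (map v xs)                             ∎
    where
    open ≡-Reasoning
    on⇔∈ : ∀ W → 𝟙 (W on? L) * v W ≡ 𝟙 (W ∈? xs) * v W
    on⇔∈ W with v W ≟ 0
    ... | yes vW≡0 rewrite vW≡0 = trans (*-zeroʳ (𝟙 (W on? L))) (sym (*-zeroʳ (𝟙 (W ∈? xs))))
    ... | no vW≢0  =
      cong (_* v W) (𝟙-cong (W on? L) (W ∈? xs) (λ W-on → covered (vW≢0 , W-on)) (lookup all-on))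

  ThinAt : Point → Set
  ThinAt X = ∀ L → X on L → card (suppOn? L ∖? [ X ]) ≤ 2

  -- Each of the q + 1 lines through P carries another support point, and one carrying exactly
  -- one carries a point of K_{p − c_P}; double counting the support then leaves no room for a
  -- line with three.
  module _ {m : ℕ} (weight+m : weight Π c + m ≡ 2 * q + 3) {P : Point} (P∈supp : Supp P)
           (partners≤m : card (λ Y → v Y ≟ p ∸ v P) ≤ m) where

    private
      others : (L : Line) → Decidable (λ Y → SuppOn L Y × Y ∉ [ P ])
      others L = suppOn? L ∖? [ P ]

      #others : Line → ℕ
      #others L = card (others L)

      others-nonempty : P on L → 1 ≤ #others L
      others-nonempty {L} P-L with #others L in eq
      ... | suc _ = s≤s z≤n
      ... | zero  = contradiction (subst (p ∣_) lineSum≡vP (c∈C⊥ L)) (¬∣-pos (n≢0⇒n>0 P∈supp) (v<p P))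
        where
        lineSum≡vP : lineSum Π c L ≡ v P
        lineSum≡vP = trans (lineSum-covered ([] ∷ []) (P-L ∷ [])
                              (card∖≤length⇒⊆++ (suppOn? L) [] [] (≤-reflexive eq)))
                           (+-identityʳ (v P))

      single-other-is-partner : P on L → #others L ≡ 1 →
                                Σ Point λ Y → Y on L × Y ≢ P × v Y ≡ p ∸ v P
      single-other-is-partner {L} P-L one = Y , Y-L , Y∉[P] ∘ here , v[Y]≡p∸v[P]
        where
        witness = card-witness (others L) (subst (0 <_) (sym one) (s≤s z≤n))
        Y = proj₁ witness
        Y∈supp = proj₁ (proj₁ (proj₂ witness))
        Y-L = proj₂ (proj₁ (proj₂ witness))
        Y∉[P] = proj₂ (proj₂ witness)

        lineSum≡ : lineSum Π c L ≡ v P + (v Y + 0)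
        lineSum≡ = lineSum-covered (((Y∉[P] ∘ here ∘ sym) ∷ []) ∷ [] ∷ []) (P-L ∷ Y-L ∷ [])
                     (card∖≤length⇒⊆++ (suppOn? L) ([] ∷ []) (proj₂ witness ∷ []) (≤-reflexive one))

        v[Y]≡p∸v[P] : v Y ≡ p ∸ v P
        v[Y]≡p∸v[P] = ∣-complement
          (subst (p ∣_) (trans lineSum≡ (cong (v P +_) (+-identityʳ (v Y)))) (c∈C⊥ L))
          (n≢0⇒n>0 Y∈supp) (v<p P) (v<p Y)

      single-other? : (L : Line) → Dec (P on L × #others L ≡ 1)
      single-other? L = P on? L ×-dec (#others L ≟ 1)

      #single-other≤m : card single-other? ≤ m
      #single-other≤m = ≤-trans (card-injection _ _ partner partner-value partner-inj) partners≤m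
        where
        partner : ∀ L → P on L × #others L ≡ 1 → Point
        partner L (P-L , one) = proj₁ (single-other-is-partner P-L one)
        partner-value : ∀ L P-L,one → v (partner L P-L,one) ≡ p ∸ v P
        partner-value L (P-L , one) = proj₂ (proj₂ (proj₂ (single-other-is-partner P-L one)))
        partner-inj : ∀ {L L′} P-L,one P-L′,one′ →
                      partner L P-L,one ≡ partner L′ P-L′,one′ → L ≡ L′
        partner-inj {L} {L′} (P-L , one) (P-L′ , one′) same =
          let (Y , Y-L , Y≢P , _) = single-other-is-partner P-L one
              (_ , Y-L′ , _ , _) = single-other-is-partner P-L′ one′
          in line-unique Y≢P Y-L P-L (subst (_on L′) (sym same) Y-L′) P-L′

      pencil-double-count : ∑[ L < nLines Π ] (𝟙 (P on? L) * #others L) ≡ card (supp? ∖? [ P ])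
      pencil-double-count = begin
        ∑[ L < nLines Π ] (𝟙 (P on? L) * #others L)
          ≡⟨ sum-cong-≗ (λ L → trans (*-distribˡ-sum (𝟙 (P on? L)) (λ Y → 𝟙 (others L Y)))
                                     (sum-cong-≗ λ Y → 𝟙-× (P on? L) (others L Y))) ⟩
        ∑[ L < nLines Π ] ∑[ Y < nPoints Π ] 𝟙 (P on? L ×-dec others L Y)
          ≡⟨ ∑-comm (λ L Y → 𝟙 (P on? L ×-dec others L Y)) ⟩
        ∑[ Y < nPoints Π ] card (λ L → P on? L ×-dec others L Y)
          ≡⟨ sum-cong-≗ (λ Y → fibre Y ((supp? ∖? [ P ]) Y)) ⟩
        card (supp? ∖? [ P ]) ∎
        where
        open ≡-Reasoning
        fibre : ∀ Y (Y? : Dec (Supp Y × Y ∉ [ P ])) →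
                card (λ L → P on? L ×-dec others L Y) ≡ 𝟙 Y?
        fibre Y (yes (Y∈supp , Y∉[P])) =
          let P≢Y = Y∉[P] ∘ here ∘ sym
              (L , P-L , Y-L) = join P Y P≢Y
          in card-unique (λ L → P on? L ×-dec others L Y) (P-L , (Y∈supp , Y-L) , Y∉[P])
               λ (P-M , (_ , Y-M) , _) → line-unique P≢Y P-M Y-M P-L Y-L
        fibre Y (no ¬Y) =
          card-∅ (λ L → P on? L ×-dec others L Y) λ L (_ , (Y∈supp , _) , Y∉[P]) → ¬Y (Y∈supp , Y∉[P])

      others+partners≡2q+2 : card (supp? ∖? [ P ]) + m ≡ 2 * suc q + 0
      others+partners≡2q+2 = suc-injective (begin
        suc (card (supp? ∖? [ P ]) + m)   ≡⟨ +-suc-assoc (card (supp? ∖? [ P ])) m ⟩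
        card (supp? ∖? [ P ]) + 1 + m     ≡⟨ cong (_+ m) (card-split supp? ([] ∷ []) (P∈supp ∷ [])) ⟨
        card supp? + m                    ≡⟨ cong (_+ m) (count≡card supp?) ⟨
        weight Π c + m                    ≡⟨ weight+m ⟩
        2 * q + 3                         ≡⟨ 2q+3 q ⟩
        suc (2 * suc q + 0)               ∎)
        where
        open ≡-Reasoning
        +-suc-assoc : ∀ a b → suc (a + b) ≡ a + 1 + b
        +-suc-assoc = solve-∀
        2q+3 : ∀ q → 2 * q + 3 ≡ suc (2 * suc q + 0)
        2q+3 = solve-∀

      many-others? : (L : Line) → Dec (P on L × 3 ≤ #others L)
      many-others? L = P on? L ×-dec (3 ≤? #others L)

      no-many-others : card many-others? ≡ 0
      no-many-others = n≤0⇒n≡0 (+-cancelˡ-≤ (2 * suc q) _ 0 (begin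
        2 * suc q + card many-others?
          ≡⟨ cong (λ k → 2 * k + card many-others?) (pencil-card P) ⟨
        2 * card (P on?_) + card many-others?
          ≡⟨ cong (_+ card many-others?) (*-distribˡ-sum 2 (λ L → 𝟙 (P on? L))) ⟩
        ∑[ L < nLines Π ] (2 * 𝟙 (P on? L)) + card many-others?
          ≡⟨ ∑-distrib-+ (λ L → 2 * 𝟙 (P on? L)) (λ L → 𝟙 (many-others? L)) ⟨
        ∑[ L < nLines Π ] (2 * 𝟙 (P on? L) + 𝟙 (many-others? L))
          ≤⟨ ∑-mono (λ L → 𝟙-two-plus-excess (P on? L) (#others L) others-nonempty) ⟩
        ∑[ L < nLines Π ] (𝟙 (P on? L) * #others L + 𝟙 (single-other? L))
          ≡⟨ ∑-distrib-+ (λ L → 𝟙 (P on? L) * #others L) (λ L → 𝟙 (single-other? L)) ⟩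
        ∑[ L < nLines Π ] (𝟙 (P on? L) * #others L) + card single-other?
          ≡⟨ cong (_+ card single-other?) pencil-double-count ⟩
        card (supp? ∖? [ P ]) + card single-other?
          ≤⟨ +-monoʳ-≤ (card (supp? ∖? [ P ])) #single-other≤m ⟩
        card (supp? ∖? [ P ]) + m
          ≡⟨ others+partners≡2q+2 ⟩
        2 * suc q + 0 ∎))
        where open ≤-Reasoning

    partners-bounded⇒thinAt : ThinAt P
    partners-bounded⇒thinAt L P-L = ≤-pred (≰⇒> λ 3≤#others →
      contradiction (card-pos many-others? (P-L , 3≤#others)) (<-irrefl (sym no-many-others)))

  record Triple (X Y Z : Point) : Set where
    field
      line : Line
      X-on : X on line
      Y-on : Y on line
      Z-on : Z on line
      X∈supp : Supp X
      Y∈supp : Supp Y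
      Z∈supp : Supp Z
      X≢Y : X ≢ Y
      X≢Z : X ≢ Z
      Y≢Z : Y ≢ Z
      covers : ∀ {W} → SuppOn line W → W ∈ X ∷ Y ∷ Z ∷ []

  module _ {X Y Z : Point} (t : Triple X Y Z) where
    open Triple t

    triple-sum : p ∣ v X + v Y + v Z
    triple-sum = subst (p ∣_) (trans lineSum≡ (assoc (v X) (v Y) (v Z))) (c∈C⊥ line)
      where
      lineSum≡ : lineSum Π c line ≡ v X + (v Y + (v Z + 0))
      lineSum≡ =
        lineSum-covered ((X≢Y ∷ X≢Z ∷ []) ∷ (Y≢Z ∷ []) ∷ [] ∷ []) (X-on ∷ Y-on ∷ Z-on ∷ []) covers
      assoc : ∀ a b c → a + (b + (c + 0)) ≡ a + b + c
      assoc = solve-∀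

    triple-swap : Triple Y X Z
    triple-swap = record
      { line = line ; X-on = Y-on ; Y-on = X-on ; Z-on = Z-on
      ; X∈supp = Y∈supp ; Y∈supp = X∈supp ; Z∈supp = Z∈supp
      ; X≢Y = X≢Y ∘ sym ; X≢Z = Y≢Z ; Y≢Z = X≢Z
      ; covers = swap ∘ covers
      }
      where
      swap : ∀ {W} → W ∈ X ∷ Y ∷ Z ∷ [] → W ∈ Y ∷ X ∷ Z ∷ []
      swap (here W≡X)         = there (here W≡X)
      swap (there (here W≡Y)) = here W≡Y
      swap (there (there W∈)) = there (there W∈)

  triple-injective : {X Y Y′ Z : Point} → Triple X Y Z → Triple X Y′ Z → Y ≡ Y′
  triple-injective t t′ with Triple.covers t (Y∈supp , subst (_ on_) same-line Y-on)
    where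
    open Triple t′
    same-line = line-unique X≢Z X-on Z-on (Triple.X-on t) (Triple.Z-on t)
  ... | here Y′≡X                 = contradiction (sym Y′≡X) (Triple.X≢Y t′)
  ... | there (here Y′≡Y)         = sym Y′≡Y
  ... | there (there (here Y′≡Z)) = contradiction Y′≡Z (Triple.Y≢Z t′)

  third-point : {X Y : Point} → ThinAt X → X ≢ Y → Supp X → Supp Y → ¬ p ∣ v X + v Y →
                Σ Point (Triple X Y)
  third-point {X} {Y} thin X≢Y X∈supp Y∈supp p∤vX+vY with join X Y X≢Y
  ... | L , X-L , Y-L with card (suppOn? L ∖? (X ∷ Y ∷ [])) in eq
  ... | zero  = contradiction (subst (p ∣_) lineSum≡ (c∈C⊥ L)) p∤vX+vY
    where
    lineSum≡ : lineSum Π c L ≡ v X + v Y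
    lineSum≡ = trans (lineSum-covered ((X≢Y ∷ []) ∷ [] ∷ []) (X-L ∷ Y-L ∷ [])
                        (card∖≤length⇒⊆++ (suppOn? L) [] [] (≤-reflexive eq)))
                     (cong (v X +_) (+-identityʳ (v Y)))
  ... | suc _ =
    let (Z , (Z∈supp , Z-L) , Z∉XY) =
          card-witness (suppOn? L ∖? (X ∷ Y ∷ [])) (subst (0 <_) (sym eq) (s≤s z≤n))
        Y≢Z = λ Y≡Z → Z∉XY (there (here (sym Y≡Z)))
        X≢Z = λ X≡Z → Z∉XY (here (sym X≡Z))
    in Z , record
      { line = L ; X-on = X-L ; Y-on = Y-L ; Z-on = Z-L
      ; X∈supp = X∈supp ; Y∈supp = Y∈supp ; Z∈supp = Z∈supp
      ; X≢Y = X≢Y ; X≢Z = X≢Z ; Y≢Z = Y≢Z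
      ; covers = card∖≤length⇒⊆++ (suppOn? L) ((Y≢Z ∷ []) ∷ [] ∷ [])
                   (((Y∈supp , Y-L) , λ { (here Y≡X) → X≢Y (sym Y≡X) }) ∷
                    ((Z∈supp , Z-L) , λ { (here Z≡X) → X≢Z (sym Z≡X) }) ∷ [])
                   (thin L X-L)
      }

  Residue : ℕ → Pred Point 0ℓ
  Residue s Y = Supp Y × p ∣ v Y + s

  residue? : (s : ℕ) → Decidable (Residue s)
  residue? s Y = supp? Y ×-dec (p ∣? v Y + s)

  card-residue-≤ : (X : Point) {x a b : ℕ} → Supp X → p ∣ v X + x → ¬ Residue a X →
                   ¬ p ∣ x + a → p ∣ x + a + b → (∀ {Y} → Residue a Y → ThinAt X ⊎ ThinAt Y) →
                   card (residue? a) ≤ card (residue? b ∖? [ X ])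
  card-residue-≤ X {x} {a} {b} X∈supp p∣vX+x X∉a p∤x+a p∣x+a+b thin =
    card-injection (residue? a) (residue? b ∖? [ X ]) (λ _ Y∈a → proj₁ (third Y∈a)) third∈b
      (λ Y∈a Y′∈a same → triple-injective (proj₂ (third Y∈a))
                                          (subst (Triple X _) (sym same) (proj₂ (third Y′∈a))))
    where
    shuffle₂ : ∀ m n r s → (m + r) + (n + s) ≡ (m + n) + (r + s)
    shuffle₂ = solve-∀
    shuffle₃ : ∀ m n o r s t → (m + r) + (n + s) + (o + t) ≡ (m + n + o) + (r + s + t)
    shuffle₃ = solve-∀

    X≢ : ∀ {Y} → Residue a Y → X ≢ Y
    X≢ Y∈a X≡Y = X∉a (subst (Residue a) (sym X≡Y) Y∈a)

    p∤vX+ : ∀ {Y} → Residue a Y → ¬ p ∣ v X + v Y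
    p∤vX+ {Y} (_ , p∣vY+a) p∣vX+vY = p∤x+a (∣m+n∣m⇒∣n
      (subst (p ∣_) (shuffle₂ (v X) (v Y) x a) (∣m∣n⇒∣m+n p∣vX+x p∣vY+a)) p∣vX+vY)

    third : ∀ {Y} → Residue a Y → Σ Point (Triple X Y)
    third {Y} Y∈a with thin Y∈a
    ... | inj₁ thinX = third-point thinX (X≢ Y∈a) X∈supp (proj₁ Y∈a) (p∤vX+ Y∈a)
    ... | inj₂ thinY =
      let (Z , t) = third-point thinY (X≢ Y∈a ∘ sym) (proj₁ Y∈a) X∈supp
                                (p∤vX+ Y∈a ∘ subst (p ∣_) (+-comm (v Y) (v X)))
      in Z , triple-swap t

    third∈b : ∀ Y Y∈a → let Z = proj₁ (third {Y} Y∈a) in Residue b Z × Z ∉ [ X ]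
    third∈b Y Y∈a@(_ , p∣vY+a) = (Z∈supp , p∣vZ+b) , λ { (here Z≡X) → X≢Z (sym Z≡X) }
      where
      open Triple (proj₂ (third Y∈a))
      Z = proj₁ (third Y∈a)
      p∣vZ+b : p ∣ v Z + b
      p∣vZ+b = ∣m+n∣m⇒∣n
        (subst (p ∣_) (sym (shuffle₃ (v X) (v Y) (v Z) x a b))
               (∣m∣n⇒∣m+n (triple-sum (proj₂ (third Y∈a))) p∣x+a+b))
        (∣m∣n⇒∣m+n p∣vX+x p∣vY+a)

-- Two value classes of equal size

module BalancedPair {q p : ℕ} (p-prime : Prime p) (3<p : 3 < p)
                    (Π : ProjectivePlane q) (c : Word Π p) (c∈C⊥ : InDualCode Π c)
                    {k m : ℕ} (0<k : 0 < k) (k<p : k < p) (weight+m : weight Π c + m ≡ 2 * q + 3)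
                    (#K[k] : Kcard Π c k ≡ m) (#K[p∸k] : Kcard Π c (p ∸ k) ≡ m) (2≤m : 2 ≤ m) where

  open Plane Π
  open Codeword Π c c∈C⊥

  private
    j : ℕ
    j = p ∸ k

    k+j≡p : k + j ≡ p
    k+j≡p = m+[n∸m]≡n (<⇒≤ k<p)

    j+k≡p : j + k ≡ p
    j+k≡p = trans (+-comm j k) k+j≡p

    0<j : 0 < j
    0<j = m<n⇒0<n∸m k<p

    j<p : j < p
    j<p = ∸-monoʳ-< 0<k (<⇒≤ k<p)

    #K[p∸j] : Kcard Π c (p ∸ j) ≡ m
    #K[p∸j] = trans (cong (Kcard Π c) (m∸[m∸n]≡n (<⇒≤ k<p))) #K[k]

    p∣n*[k+j] : ∀ n → p ∣ n * (k + j)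
    p∣n*[k+j] n = subst (λ p′ → p ∣ n * p′) (sym k+j≡p) (n∣m*n n)

    p∣k+j : p ∣ k + j
    p∣k+j = subst (p ∣_) (sym k+j≡p) ∣-refl

    p∤k : ¬ p ∣ k
    p∤k = ¬∣-pos 0<k k<p

    p∤2* : ∀ {t} → 0 < t → t < p → ¬ p ∣ 2 * t
    p∤2* = p∤n*t p-prime (s≤s z≤n) (<-trans (n<1+n 2) 3<p)

    p∤3* : ∀ {t} → 0 < t → t < p → ¬ p ∣ 3 * t
    p∤3* = p∤n*t p-prime (s≤s z≤n) 3<p

    p∤4* : ∀ {t} → 0 < t → t < p → ¬ p ∣ 2 * (2 * t)
    p∤4* {t} 0<t t<p p∣4t with euclidsLemma 2 (2 * t) p-prime p∣4t
    ... | inj₁ p∣2  = ¬∣-pos (s≤s z≤n) (<-trans (n<1+n 2) 3<p) p∣2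
    ... | inj₂ p∣2t = p∤2* 0<t t<p p∣2t

    residue⇒value : ∀ {t s Y} → t + s ≡ p → s < p → Residue s Y → v Y ≡ t
    residue⇒value {t} {s} {Y} t+s≡p s<p (Y∈supp , p∣vY+s) = begin
      v Y       ≡⟨ ∣-complement (subst (p ∣_) (+-comm (v Y) s) p∣vY+s) (n≢0⇒n>0 Y∈supp) s<p (v<p Y) ⟩
      p ∸ s     ≡⟨ cong (_∸ s) t+s≡p ⟨
      t + s ∸ s ≡⟨ m+n∸n≡m t s ⟩
      t         ∎
      where open ≡-Reasoning

    value⇒residue : ∀ {t s Y} → 0 < t → t + s ≡ p → v Y ≡ t → Residue s Y
    value⇒residue {s = s} 0<t t+s≡p vY≡t =
      (λ vY≡0 → <⇒≢ 0<t (trans (sym vY≡0) vY≡t)) ,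
      subst (p ∣_) (trans (sym t+s≡p) (cong (_+ s) (sym vY≡t))) ∣-refl

    Kcard≡card-residue : ∀ {t s} → 0 < t → t + s ≡ p → s < p → Kcard Π c t ≡ card (residue? s)
    Kcard≡card-residue {t} {s} 0<t t+s≡p s<p = trans (Kcard≡card t)
      (card-cong (λ Y → v Y ≟ t) (residue? s) (value⇒residue 0<t t+s≡p) (residue⇒value t+s≡p s<p))

    #residue[j] : card (residue? j) ≡ m
    #residue[j] = trans (sym (Kcard≡card-residue 0<k k+j≡p j<p)) #K[k]

    #residue[k] : card (residue? k) ≡ m
    #residue[k] = trans (sym (Kcard≡card-residue 0<j j+k≡p k<p)) #K[p∸k]

    thinAt-value : ∀ {Y t} → Supp Y → v Y ≡ t → Kcard Π c (p ∸ t) ≡ m → ThinAt Y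
    thinAt-value Y∈supp refl #partners =
      partners-bounded⇒thinAt weight+m Y∈supp (≤-reflexive (trans (sym (Kcard≡card _)) #partners))

    thinAt-residue[j] : ∀ {Y} → Residue j Y → ThinAt Y
    thinAt-residue[j] Y∈j = thinAt-value (proj₁ Y∈j) (residue⇒value k+j≡p j<p Y∈j) #K[p∸k]

    thinAt-residue[k] : ∀ {Y} → Residue k Y → ThinAt Y
    thinAt-residue[k] Y∈k = thinAt-value (proj₁ Y∈k) (residue⇒value j+k≡p k<p Y∈k) #K[p∸j]

    0<m : 0 < m
    0<m = ≤-trans (s≤s z≤n) 2≤m

    P₀-witness = card-witness (residue? j) (subst (0 <_) (sym #residue[j]) 0<m)
    P₀ = proj₁ P₀-witness
    P₀∈j = proj₂ P₀-witness
    v[P₀]≡k = residue⇒value k+j≡p j<p P₀∈j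

    #others[j] : card (residue? j ∖? [ P₀ ]) + 1 ≡ m
    #others[j] = trans (sym (card-split (residue? j) ([] ∷ []) (P₀∈j ∷ []))) #residue[j]

    P′-witness = card-witness (residue? j ∖? [ P₀ ])
                   (+-cancelʳ-≤ 1 1 (card (residue? j ∖? [ P₀ ])) (subst (2 ≤_) (sym #others[j]) 2≤m))
    P′ = proj₁ P′-witness
    P′∈j = proj₁ (proj₂ P′-witness)
    v[P′]≡k = residue⇒value k+j≡p j<p P′∈j

    Q₀-witness = card-witness (residue? k) (subst (0 <_) (sym #residue[k]) 0<m)
    Q₀ = proj₁ Q₀-witness
    Q₀∈k = proj₂ Q₀-witness
    v[Q₀]≡j = residue⇒value j+k≡p k<p Q₀∈k

    R-witness : Σ Point (Triple P₀ P′)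
    R-witness = third-point (thinAt-residue[j] P₀∈j) (proj₂ (proj₂ P′-witness) ∘ here ∘ sym)
                  (proj₁ P₀∈j) (proj₁ P′∈j)
                  (p∤2* 0<k k<p ∘ subst (p ∣_) (trans (cong₂ _+_ v[P₀]≡k v[P′]≡k) (k+k≡2k k)))
      where k+k≡2k : ∀ k → k + k ≡ 2 * k
            k+k≡2k = solve-∀
    R = proj₁ R-witness

    R∈2k : Residue (2 * k) R
    R∈2k = Triple.Z∈supp (proj₂ R-witness) ,
           subst (p ∣_) (trans (cong (_+ v R) (cong₂ _+_ v[P₀]≡k v[P′]≡k)) (rearrange k (v R)))
             (triple-sum (proj₂ R-witness))
      where rearrange : ∀ k r → k + k + r ≡ r + 2 * k
            rearrange = solve-∀

    #residue[k]≤#residue[3j] : card (residue? k) ≤ card (residue? (3 * j))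
    #residue[k]≤#residue[3j] = ≤-trans
      (card-residue-≤ R (proj₁ R∈2k) (proj₂ R∈2k)
        (λ (_ , p∣vR+k) → p∤k (∣m+n∣m⇒∣n (subst (p ∣_) (i₁ (v R) k) (proj₂ R∈2k)) p∣vR+k))
        (p∤3* 0<k k<p ∘ subst (p ∣_) (i₂ k))
        (subst (p ∣_) (sym (i₃ k j)) (p∣n*[k+j] 3))
        (λ Y∈k → inj₂ (thinAt-residue[k] Y∈k)))
      (card-mono (residue? (3 * j) ∖? [ R ]) (residue? (3 * j)) proj₁)
      where i₁ : ∀ r k → r + 2 * k ≡ (r + k) + k
            i₁ = solve-∀
            i₂ : ∀ k → 2 * k + k ≡ 3 * k
            i₂ = solve-∀
            i₃ : ∀ k j → 2 * k + k + 3 * j ≡ 3 * (k + j)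
            i₃ = solve-∀

    #residue[3j]≤#residue[2k] : card (residue? (3 * j)) ≤ card (residue? (2 * k))
    #residue[3j]≤#residue[2k] = ≤-trans
      (card-residue-≤ Q₀ (proj₁ Q₀∈k) (proj₂ Q₀∈k)
        (λ (_ , p∣vQ₀+3j) → p∤4* 0<j j<p (subst (p ∣_) (trans (cong (_+ 3 * j) v[Q₀]≡j) (i₁ j)) p∣vQ₀+3j))
        (λ p∣k+3j → p∤2* 0<k k<p (∣m+n∣m⇒∣n (subst (p ∣_) (sym (i₂ k j)) (p∣n*[k+j] 3)) p∣k+3j))
        (subst (p ∣_) (sym (i₂ k j)) (p∣n*[k+j] 3))
        (λ _ → inj₁ (thinAt-residue[k] Q₀∈k)))
      (card-mono (residue? (2 * k) ∖? [ Q₀ ]) (residue? (2 * k)) proj₁)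
      where i₁ : ∀ j → j + 3 * j ≡ 2 * (2 * j)
            i₁ = solve-∀
            i₂ : ∀ k j → k + 3 * j + 2 * k ≡ 3 * (k + j)
            i₂ = solve-∀

    #residue[2k]≤#others[j] : card (residue? (2 * k)) ≤ card (residue? j ∖? [ P₀ ])
    #residue[2k]≤#others[j] = card-residue-≤ P₀ (proj₁ P₀∈j) (proj₂ P₀∈j)
      (λ (_ , p∣vP₀+2k) → p∤3* 0<k k<p (subst (p ∣_) (trans (cong (_+ 2 * k) v[P₀]≡k) (i₁ k)) p∣vP₀+2k))
      (λ p∣j+2k → p∤k (∣m+n∣m⇒∣n (subst (p ∣_) (i₂ k j) p∣j+2k) p∣k+j))
      (subst (p ∣_) (sym (i₃ k j)) (p∣n*[k+j] 2))
      (λ _ → inj₁ (thinAt-residue[j] P₀∈j))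
      where i₁ : ∀ k → k + 2 * k ≡ 3 * k
            i₁ = solve-∀
            i₂ : ∀ k j → j + 2 * k ≡ (k + j) + k
            i₂ = solve-∀
            i₃ : ∀ k j → j + 2 * k + j ≡ 2 * (k + j)
            i₃ = solve-∀

  impossible : ⊥
  impossible = <-irrefl refl (begin-strict
    card (residue? j ∖? [ P₀ ])       <⟨ m<m+n _ (s≤s z≤n) ⟩
    card (residue? j ∖? [ P₀ ]) + 1   ≡⟨ #others[j] ⟩
    m                                 ≡⟨ #residue[k] ⟨
    card (residue? k)                 ≤⟨ #residue[k]≤#residue[3j] ⟩
    card (residue? (3 * j))           ≤⟨ #residue[3j]≤#residue[2k] ⟩
    card (residue? (2 * k))           ≤⟨ #residue[2k]≤#others[j] ⟩
    card (residue? j ∖? [ P₀ ])       ∎)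
    where open ≤-Reasoning

weight+partners : ∀ p ε → 1 ≤ p → ε ≤ p ∸ 2 →
                  (2 * p * p ∸ 2 * p + 2 + ε) + (2 * p + 1 ∸ ε) ≡ 2 * (p * p) + 3
weight+partners p ε 1≤p ε≤p∸2 = begin
  (a + 2 + ε) + (2 * p + 1 ∸ ε)   ≡⟨ +-assoc (a + 2) ε _ ⟩
  a + 2 + (ε + (2 * p + 1 ∸ ε))   ≡⟨ cong (a + 2 +_) (m+[n∸m]≡n ε≤2p+1) ⟩
  a + 2 + (2 * p + 1)             ≡⟨ regroup a (2 * p) ⟩
  (a + 2 * p) + 3                 ≡⟨ cong (_+ 3) (m∸n+n≡m 2p≤2p*p) ⟩
  2 * p * p + 3                   ≡⟨ cong (_+ 3) (*-assoc 2 p p) ⟩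
  2 * (p * p) + 3                 ∎
  where
  open ≡-Reasoning
  a = 2 * p * p ∸ 2 * p
  ε≤2p+1 : ε ≤ 2 * p + 1
  ε≤2p+1 = ≤-trans ε≤p∸2 (≤-trans (m∸n≤m p 2) (≤-trans (m≤m+n p (p + 0)) (m≤m+n (2 * p) 1)))
  2p≤2p*p : 2 * p ≤ 2 * p * p
  2p≤2p*p = subst (_≤ 2 * p * p) (*-identityʳ (2 * p)) (*-monoʳ-≤ (2 * p) 1≤p)
  regroup : ∀ a b → a + 2 + (b + 1) ≡ (a + b) + 3
  regroup = solve-∀

2≤partners : ∀ p ε → 1 ≤ p → ε ≤ p ∸ 2 → 2 ≤ 2 * p + 1 ∸ ε
2≤partners p ε 1≤p ε≤p∸2 = m+n≤o⇒m≤o∸n 2 (begin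
  2 + ε         ≤⟨ +-monoʳ-≤ 2 (≤-trans ε≤p∸2 (m∸n≤m p 2)) ⟩
  2 + p         ≤⟨ +-monoˡ-≤ (1 + p) 1≤p ⟩
  p + (1 + p)   ≡⟨ regroup p ⟩
  2 * p + 1     ∎)
  where
  open ≤-Reasoning
  regroup : ∀ p → p + (1 + p) ≡ 2 * p + 1
  regroup = solve-∀

mainTheorem18 : (p : ℕ) → Prime p → 3 < p →
    (Π : ProjectivePlane (p * p)) → (c : Word Π p) → InDualCode Π c →
    (ε : ℕ) → 1 ≤ ε → ε ≤ p ∸ 2 →
    weight Π c ≡ (2 * p * p ∸ 2 * p) + 2 + ε →
    ¬ (Σ ℕ λ k → (1 ≤ k) × (k ≤ p ∸ 1) ×
         (Σ (Fin (nPoints Π)) λ P → toℕ (c P) ≡ k) ×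
         (Kcard Π c k ≡ 2 * p + 1 ∸ ε) × (Kcard Π c (p ∸ k) ≡ 2 * p + 1 ∸ ε))
-- Neither 1 ≤ ε nor the point with entry k is needed: ε ≤ p − 2 already makes |K_k| ≥ 2.
mainTheorem18 p p-prime 3<p Π c c∈C⊥ ε _ ε≤p∸2 weight≡ (k , 1≤k , k≤p∸1 , _ , #K[k] , #K[p∸k]) =
  BalancedPair.impossible p-prime 3<p Π c c∈C⊥ 1≤k (≤∸1⇒< 0<p k≤p∸1) weight+m #K[k] #K[p∸k]
    (2≤partners p ε 0<p ε≤p∸2)
  where
  0<p : 0 < p
  0<p = <-trans (s≤s z≤n) 3<p
  weight+m : weight Π c + (2 * p + 1 ∸ ε) ≡ 2 * (p * p) + 3
  weight+m = trans (cong (_+ (2 * p + 1 ∸ ε)) weight≡) (weight+partners p ε 0<p ε≤p∸2)
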